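{- Let $k\ge 1$ and $\nu>k$ be integers. Then for every $(N,D)\in\Delta(\nu,k,k)$, $$\frac{R^*(N,D)}{R(N,D)} \le \frac{2}{\sum_{h=0}^k \binom{\nu}{h}\binom{\nu-1-h}{k-h}+1}.$$
   Context: An array with $\nu$ columns over $\{0,1\}$ is a finite sequence of rows in $\{0,1\}^\nu$. For integers $k>0$, $d\ge k$, $\nu\ge d$, $\Delta(\nu,d,k)$ is the set of pairs $(N,D)$ of arrays with $\nu$ columns over $\{0,1\}$ such that: $N$ contains at least one occurrence of the all-ones row $(1,\ldots,1)$; each row of $D$ has at most $d$ non-zero coordinates; and for every choice of $k$ columns, extracting these $k$ columns from $N$ and from $D$ yields the same array up to the order of rows (so $N$ and $D$ have the same number of rows). $R^*(N,D)$ denotes the number of occurrences of the all-ones row in $N$ and $R(N,D)$ the number of rows of $D$. -}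

module Defs where

open import Data.Nat using (ℕ; zero; suc; _+_; _*_; _∸_; _≤_)
open import Data.Nat.Combinatorics using (_C_)
open import Data.Bool using (Bool; true; false; if_then_else_)
open import Data.Vec using (Vec; []; _∷_)
open import Data.List using (List; []; _∷_; length; map; upTo)
open import Data.Nat.ListAction using (sum)
open import Data.List.Membership.Propositional using (_∈_)
open import Data.List.Relation.Binary.Permutation.Propositional using (_↭_)
open import Data.Fin.Subset using (Subset; ∣_∣; inside; outside)
open import Relation.Binary.PropositionalEquality using (_≡_)
open import Data.Product using (_×_)

-- A row with ν columns over {0,1}; false = 0, true = 1.
Row : ℕ → Set
Row ν = Vec Bool ν

Array : ℕ → Set
Array ν = List (Row ν)

ones : (ν : ℕ) → Row ν
ones zero = []
ones (suc ν) = true ∷ ones ν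

weight : ∀ {ν} → Row ν → ℕ
weight [] = 0
weight (true ∷ r) = suc (weight r)
weight (false ∷ r) = weight r

_=ᵇ_ : ∀ {ν} → Row ν → Row ν → Bool
[] =ᵇ [] = true
(true ∷ r) =ᵇ (true ∷ s) = r =ᵇ s
(false ∷ r) =ᵇ (false ∷ s) = r =ᵇ s
(true ∷ r) =ᵇ (false ∷ s) = false
(false ∷ r) =ᵇ (true ∷ s) = false

extract : ∀ {ν} (S : Subset ν) → Row ν → Vec Bool ∣ S ∣
extract [] [] = []
extract (inside ∷ S) (b ∷ r) = b ∷ extract S r
extract (outside ∷ S) (b ∷ r) = extract S r

extractArr : ∀ {ν} (S : Subset ν) → Array ν → List (Vec Bool ∣ S ∣)
extractArr S A = map (extract S) A

record InΔ (ν d k : ℕ) (N D : Array ν) : Set where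
  field
    hasOnes   : ones ν ∈ N
    weightD   : ∀ {r} → r ∈ D → weight r ≤ d
    kMarginal : (S : Subset ν) → ∣ S ∣ ≡ k → extractArr S N ↭ extractArr S D

Rstar : ∀ {ν} → Array ν → ℕ
Rstar {ν} [] = 0
Rstar {ν} (r ∷ N) = (if r =ᵇ ones ν then 1 else 0) + Rstar N

R : ∀ {ν} → Array ν → ℕ
R D = length D

bound : ℕ → ℕ → ℕ
bound ν k = sum (map (λ h → (ν C h) * ((ν ∸ 1 ∸ h) C (k ∸ h))) (upTo (suc k)))

{-# OPTIONS --safe #-}
module Submission where

-- Let q k w = Σ_{j ≤ k} (-1)^(k-j) 2^j C(w,j), so that q (j+1) w + q j w = 2^(j+1) C(w,j+1),
-- and put F k w = 1 + q k w. Since Σ_{r ∈ A} C(weight r, h) counts the pairs (r, T) with T an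
-- h-set of columns on which r is 1, it only depends on the h-marginals of A, hence on its
-- k-marginals when h ≤ k; so Σ_{r ∈ A} F k (weight r) is the same for A = N and A = D.
-- On weights w ≤ k, q k w = ±1, so 0 ≤ F k w ≤ 2; for w ≥ k, q k w = Σ_h C(w,h) C(w-1-h,k-h),
-- as both sides obey the Pascal rule q (k+1) (w+1) = q (k+1) w + 2 q k w. Every all-ones row
-- of N thus contributes 1 + bound ν k, and every row of D at most 2.

open import Defs
open import Data.Nat
open import Data.Nat.Properties
open import Data.Nat.Combinatorics using (_C_; nCn≡1; k>n⇒nCk≡0; nCk+nC[k+1]≡[n+1]C[k+1])
open import Data.Nat.ListAction using (sum)
open import Data.Nat.ListAction.Properties using (sum-++; sum-↭)
open import Data.Nat.Tactic.RingSolver using (solve-∀)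
open import Data.Integer as ℤ using (ℤ; 0ℤ; 1ℤ; -1ℤ)
import Data.Integer.Properties as ℤₚ
import Data.Integer.Tactic.RingSolver as ℤ-Ring
open import Data.Bool using (true; false)
open import Data.Vec using ([]; _∷_)
import Data.Vec as Vec
open import Data.List using (List; []; _∷_; _++_; [_]; map; length; upTo; _∷ʳ_)
open import Data.List.Properties
  using (map-++; map-cong; map-cong-local; map-∘; map-applyUpTo; map-upTo; upTo-∷ʳ)
open import Data.List.Membership.Propositional using (_∈_)
open import Data.List.Relation.Unary.Any using (here; there)
open import Data.List.Relation.Unary.All as All using (All; []; _∷_)
open import Data.List.Relation.Unary.All.Properties using (all-upTo; ++⁺; map⁺)
open import Data.List.Relation.Binary.Permutation.Propositional using (_↭_)
import Data.List.Relation.Binary.Permutation.Propositional.Properties as ↭ₚ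
open import Data.Fin.Subset using (Subset; ∣_∣; inside; outside; _⊆_)
open import Data.Fin.Subset.Properties using (⊆-refl; drop-∷-⊆; in⊆in; out⊆; s⊆s; ∣p∣≤n)
open import Data.Product using (∃-syntax; _×_; _,_)
open import Data.Sum as Sum using (_⊎_; inj₁; inj₂)
open import Function using (_∘_)
open import Relation.Nullary using (yes; no)
open import Relation.Binary.PropositionalEquality
  using (_≡_; refl; sym; trans; cong; cong₂; subst; module ≡-Reasoning)

open import Algebra.Properties.CommutativeSemigroup +-commutativeSemigroup
  using (xy∙z≈xz∙y) renaming (interchange to +-interchange)

private
  variable
    A B : Set
    ν k : ℕ

sum-map-zero : (xs : List A) → sum (map (λ _ → 0) xs) ≡ 0
sum-map-zero []       = refl
sum-map-zero (x ∷ xs) = sum-map-zero xs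

sum-map-+ : (f g : A → ℕ) (xs : List A) →
  sum (map (λ x → f x + g x) xs) ≡ sum (map f xs) + sum (map g xs)
sum-map-+ f g []       = refl
sum-map-+ f g (x ∷ xs) = trans (cong ((f x + g x) +_) (sum-map-+ f g xs)) (+-interchange (f x) (g x) _ _)

sum-map-* : (c : ℕ) (f : A → ℕ) (xs : List A) → sum (map (λ x → c * f x) xs) ≡ c * sum (map f xs)
sum-map-* c f []       = sym (*-zeroʳ c)
sum-map-* c f (x ∷ xs) = trans (cong (c * f x +_) (sum-map-* c f xs)) (sym (*-distribˡ-+ c (f x) _))

sum-map-swap : (f : A → B → ℕ) (xs : List A) (ys : List B) →
  sum (map (λ x → sum (map (f x) ys)) xs) ≡ sum (map (λ y → sum (map (λ x → f x y) xs)) ys)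
sum-map-swap f []       ys = sym (sum-map-zero ys)
sum-map-swap f (x ∷ xs) ys =
  trans (cong (sum (map (f x) ys) +_) (sum-map-swap f xs ys)) (sym (sum-map-+ (f x) _ ys))

sum-map-≤ : {f : A → ℕ} {c : ℕ} {xs : List A} → (∀ {x} → x ∈ xs → f x ≤ c) →
  sum (map f xs) ≤ c * length xs
sum-map-≤ {xs = []}     f≤c = z≤n
sum-map-≤ {f = f} {c} {x ∷ xs} f≤c = subst (sum (map f (x ∷ xs)) ≤_) (sym (*-suc c (length xs)))
  (+-mono-≤ (f≤c (here refl)) (sum-map-≤ (f≤c ∘ there)))

sum-upTo-suc : (f : ℕ → ℕ) (n : ℕ) → sum (map f (upTo (suc n))) ≡ f 0 + sum (map (f ∘ suc) (upTo n))
sum-upTo-suc f n =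
  cong (λ xs → f 0 + sum xs) (trans (map-applyUpTo suc f n) (sym (map-upTo (f ∘ suc) n)))

sum-upTo-∷ʳ : (f : ℕ → ℕ) (n : ℕ) → sum (map f (upTo (suc n))) ≡ sum (map f (upTo n)) + f n
sum-upTo-∷ʳ f n = begin
  sum (map f (upTo (suc n)))        ≡⟨ cong (sum ∘ map f) (upTo-∷ʳ n) ⟨
  sum (map f (upTo n ∷ʳ n))         ≡⟨ cong sum (map-++ f (upTo n) [ n ]) ⟩
  sum (map f (upTo n) ++ [ f n ])   ≡⟨ sum-++ (map f (upTo n)) [ f n ] ⟩
  sum (map f (upTo n)) + (f n + 0)  ≡⟨ cong (sum (map f (upTo n)) +_) (+-identityʳ (f n)) ⟩
  sum (map f (upTo n)) + f n        ∎
  where open ≡-Reasoning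

sum-upTo-cong : {f g : ℕ → ℕ} (n : ℕ) → (∀ {h} → h < n → f h ≡ g h) →
  sum (map f (upTo n)) ≡ sum (map g (upTo n))
sum-upTo-cong n f≡g = cong sum (map-cong-local (All.map f≡g (all-upTo n)))

-- Pascal recurrence for bound

-- bound w k is definitionally sum (map (bound-term w k) (upTo (suc k))).
bound-term : ℕ → ℕ → ℕ → ℕ
bound-term w k h = (w C h) * ((w ∸ 1 ∸ h) C (k ∸ h))

C-pascal : ∀ n k → suc n C suc k ≡ n C k + n C suc k
C-pascal n k = sym (nCk+nC[k+1]≡[n+1]C[k+1] n k)

bound-diagonal : ∀ k → bound k k ≡ 1
bound-diagonal k = begin
  bound k k                                  ≡⟨ sum-upTo-∷ʳ t k ⟩
  sum (map t (upTo k)) + t k                 ≡⟨ cong (_+ t k) (sum-upTo-cong k vanishes) ⟩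
  sum (map (λ _ → 0) (upTo k)) + t k         ≡⟨ cong₂ _+_ (sum-map-zero (upTo k)) diagonal ⟩
  1                                          ∎
  where
  open ≡-Reasoning
  t : ℕ → ℕ
  t = bound-term k k
  vanishes : ∀ {h} → h < k → t h ≡ 0
  vanishes {h} h<k = trans (cong ((k C h) *_) (k>n⇒nCk≡0 k∸1∸h<k∸h)) (*-zeroʳ (k C h))
    where
    k∸1∸h<k∸h : k ∸ 1 ∸ h < k ∸ h
    k∸1∸h<k∸h = subst (_< k ∸ h) (sym (∸-+-assoc k 1 h)) (∸-monoʳ-< (n<1+n h) h<k)
  diagonal : t k ≡ 1
  diagonal = cong₂ (λ c d → c * ((k ∸ 1 ∸ k) C d)) (nCn≡1 k) (n∸n≡0 k)

bound-tail : ℕ → ℕ → ℕ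
bound-tail a k = sum (map (bound-term (suc a) k ∘ suc) (upTo k))

bound-peel : ∀ a k → bound (suc a) k ≡ a C k + bound-tail a k
bound-peel a k =
  trans (sum-upTo-suc (bound-term (suc a) k) k) (cong (_+ bound-tail a k) (*-identityˡ (a C k)))

bound-tail-pascal : ∀ {a k} → k ≤ a →
  sum (map (λ g → ((1 + a) C (1 + g)) * ((a ∸ g) C (k ∸ g))) (upTo (1 + k))) ≡
  bound-tail a (1 + k) + bound-tail a k
bound-tail-pascal {a} {k} k≤a = begin
  sum (map x (upTo (1 + k)))                   ≡⟨ sum-upTo-∷ʳ x k ⟩
  sum (map x (upTo k)) + x k                   ≡⟨ cong₂ _+_ (sum-upTo-cong k x≡y+z) xk≡yk ⟩
  sum (map (λ g → y g + z g) (upTo k)) + y k   ≡⟨ cong (_+ y k) (sum-map-+ y z (upTo k)) ⟩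
  sum (map y (upTo k)) + bound-tail a k + y k  ≡⟨ xy∙z≈xz∙y _ (bound-tail a k) (y k) ⟩
  sum (map y (upTo k)) + y k + bound-tail a k  ≡⟨ cong (_+ bound-tail a k) (sum-upTo-∷ʳ y k) ⟨
  bound-tail a (1 + k) + bound-tail a k        ∎
  where
  open ≡-Reasoning
  x y z : ℕ → ℕ
  x g = ((1 + a) C (1 + g)) * ((a ∸ g) C (k ∸ g))
  y   = bound-term (suc a) (suc k) ∘ suc
  z   = bound-term (suc a) k ∘ suc
  x≡y+z : ∀ {g} → g < k → x g ≡ y g + z g
  x≡y+z {g} g<k = begin
    x g                            ≡⟨ cong₂ (λ n j → c * (n C j)) a∸g k∸g ⟩
    c * (suc d C suc e)            ≡⟨ cong (c *_) (C-pascal d e) ⟩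
    c * (d C e + d C suc e)        ≡⟨ *-distribˡ-+ c (d C e) (d C suc e) ⟩
    c * (d C e) + c * (d C suc e)  ≡⟨ +-comm (c * (d C e)) (c * (d C suc e)) ⟩
    c * (d C suc e) + z g          ≡⟨ cong (λ j → c * (d C j) + z g) k∸g ⟨
    y g + z g                      ∎
    where
    c d e : ℕ
    c = (1 + a) C (1 + g)
    d = a ∸ suc g
    e = k ∸ suc g
    a∸g : a ∸ g ≡ suc d
    a∸g = +-∸-assoc 1 (<-≤-trans g<k k≤a)
    k∸g : k ∸ g ≡ suc e
    k∸g = +-∸-assoc 1 g<k
  xk≡yk : x k ≡ y k
  xk≡yk = trans (cong (λ j → ((1 + a) C (1 + k)) * ((a ∸ k) C j)) (n∸n≡0 k))
                (cong (λ j → ((1 + a) C (1 + k)) * ((a ∸ suc k) C j)) (sym (n∸n≡0 k)))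

bound-pascal : ∀ {k w} → k < w → bound (suc w) (suc k) ≡ bound w (suc k) + 2 * bound w k
bound-pascal {k} {suc a} (s≤s k≤a) = begin
    bound (2 + a) (1 + k)
  ≡⟨ bound-peel (1 + a) (1 + k) ⟩
    (1 + a) C (1 + k) + sum (map (λ g → ((2 + a) C (1 + g)) * m g) (upTo (1 + k)))
  ≡⟨ cong₂ _+_ (C-pascal a k) (trans (cong sum (map-cong split (upTo (1 + k))))
                                      (sum-map-+ (bound-term (1 + a) k) x (upTo (1 + k)))) ⟩
    (a C k + a C (1 + k)) + (bound (1 + a) k + sum (map x (upTo (1 + k))))
  ≡⟨ cong₂ (λ b t → (a C k + a C (1 + k)) + (b + t)) (bound-peel a k) (bound-tail-pascal k≤a) ⟩
    (a C k + a C (1 + k)) + ((a C k + bound-tail a k) + (bound-tail a (1 + k) + bound-tail a k))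
  ≡⟨ rearrange (a C k) (a C (1 + k)) (bound-tail a (1 + k)) (bound-tail a k) ⟩
    (a C (1 + k) + bound-tail a (1 + k)) + 2 * (a C k + bound-tail a k)
  ≡⟨ cong₂ (λ b₁ b₀ → b₁ + 2 * b₀) (bound-peel a (1 + k)) (bound-peel a k) ⟨
    bound (1 + a) (1 + k) + 2 * bound (1 + a) k
  ∎
  where
  open ≡-Reasoning
  m x : ℕ → ℕ
  m g = (a ∸ g) C (k ∸ g)
  x g = ((1 + a) C (1 + g)) * m g
  split : ∀ g → ((2 + a) C (1 + g)) * m g ≡ ((1 + a) C g) * m g + x g
  split g = trans (cong (_* m g) (C-pascal (1 + a) g))
                  (*-distribʳ-+ (m g) ((1 + a) C g) ((1 + a) C (1 + g)))
  rearrange : ∀ c₀ c₁ t₁ t₀ →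
    (c₀ + c₁) + ((c₀ + t₀) + (t₁ + t₀)) ≡ (c₁ + t₁) + 2 * (c₀ + t₀)
  rearrange = solve-∀

-- The polynomial q and the row score F

q : ℕ → ℕ → ℤ
q zero    w = 1ℤ
q (suc j) w = ℤ.+ (2 ^ suc j * (w C suc j)) ℤ.- q j w

q-pascal : ∀ k w → q (suc k) (suc w) ≡ q (suc k) w ℤ.+ ℤ.+ 2 ℤ.* q k w
q-pascal zero w = begin
    ℤ.+ (2 * (suc w C 1)) ℤ.- 1ℤ
  ≡⟨ cong (λ n → ℤ.+ (2 * n) ℤ.- 1ℤ) (C-pascal w 0) ⟩
    ℤ.+ (2 * (1 + w C 1)) ℤ.- 1ℤ
  ≡⟨ cong (λ n → ℤ.+ n ℤ.- 1ℤ) (*-distribˡ-+ 2 1 (w C 1)) ⟩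
    (ℤ.+ 2 ℤ.+ T) ℤ.- 1ℤ
  ≡⟨ identity T ⟩
    (T ℤ.- 1ℤ) ℤ.+ ℤ.+ 2 ℤ.* 1ℤ
  ∎
  where
  open ≡-Reasoning
  T : ℤ
  T = ℤ.+ (2 * (w C 1))
  identity : ∀ T → (ℤ.+ 2 ℤ.+ T) ℤ.- 1ℤ ≡ (T ℤ.- 1ℤ) ℤ.+ ℤ.+ 2 ℤ.* 1ℤ
  identity = ℤ-Ring.solve-∀
q-pascal (suc k) w = begin
    ℤ.+ (2 ^ (2 + k) * (suc w C (2 + k))) ℤ.- q (1 + k) (1 + w)
  ≡⟨ cong₂ ℤ._-_ (cong ℤ.+_ split) (q-pascal k w) ⟩
    ℤ.+ (2 * (c * (w C (1 + k)))) ℤ.+ T ℤ.- ((U ℤ.- Q) ℤ.+ ℤ.+ 2 ℤ.* Q)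
  ≡⟨ cong (λ i → i ℤ.+ T ℤ.- ((U ℤ.- Q) ℤ.+ ℤ.+ 2 ℤ.* Q)) (ℤₚ.pos-* 2 (c * (w C (1 + k)))) ⟩
    ℤ.+ 2 ℤ.* U ℤ.+ T ℤ.- ((U ℤ.- Q) ℤ.+ ℤ.+ 2 ℤ.* Q)
  ≡⟨ identity U Q T ⟩
    (T ℤ.- (U ℤ.- Q)) ℤ.+ ℤ.+ 2 ℤ.* (U ℤ.- Q)
  ∎
  where
  open ≡-Reasoning
  c : ℕ
  c = 2 ^ suc k
  U Q T : ℤ
  U = ℤ.+ (c * (w C (1 + k)))
  Q = q k w
  T = ℤ.+ (2 ^ (2 + k) * (w C (2 + k)))
  split : 2 ^ (2 + k) * (suc w C (2 + k)) ≡ 2 * (c * (w C (1 + k))) + 2 ^ (2 + k) * (w C (2 + k))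
  split = trans (cong (2 ^ (2 + k) *_) (C-pascal w (1 + k)))
                (trans (*-distribˡ-+ (2 ^ (2 + k)) (w C (1 + k)) (w C (2 + k)))
                       (cong (_+ 2 ^ (2 + k) * (w C (2 + k))) (*-assoc 2 c (w C (1 + k)))))
  identity : ∀ U Q T → ℤ.+ 2 ℤ.* U ℤ.+ T ℤ.- ((U ℤ.- Q) ℤ.+ ℤ.+ 2 ℤ.* Q) ≡
                       (T ℤ.- (U ℤ.- Q)) ℤ.+ ℤ.+ 2 ℤ.* (U ℤ.- Q)
  identity = ℤ-Ring.solve-∀

q-alternates : ∀ {k w} → w ≤ k → q (suc k) w ≡ ℤ.- q k w
q-alternates {k} {w} w≤k = begin
  ℤ.+ (2 ^ suc k * (w C suc k)) ℤ.- q k w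
    ≡⟨ cong (λ n → ℤ.+ (2 ^ suc k * n) ℤ.- q k w) (k>n⇒nCk≡0 (s≤s w≤k)) ⟩
  ℤ.+ (2 ^ suc k * 0) ℤ.- q k w
    ≡⟨ cong (λ n → ℤ.+ n ℤ.- q k w) (*-zeroʳ (2 ^ suc k)) ⟩
  0ℤ ℤ.- q k w
    ≡⟨ ℤₚ.+-identityˡ (ℤ.- q k w) ⟩
  ℤ.- q k w
    ∎
  where open ≡-Reasoning

q-diagonal : ∀ k → q k k ≡ 1ℤ
q-diagonal zero    = refl
q-diagonal (suc k) = begin
  q (suc k) (suc k)                ≡⟨ q-pascal k k ⟩
  q (suc k) k ℤ.+ ℤ.+ 2 ℤ.* q k k  ≡⟨ cong (ℤ._+ ℤ.+ 2 ℤ.* q k k) (q-alternates {k} ≤-refl) ⟩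
  ℤ.- q k k ℤ.+ ℤ.+ 2 ℤ.* q k k    ≡⟨ cong (λ i → ℤ.- i ℤ.+ ℤ.+ 2 ℤ.* i) (q-diagonal k) ⟩
  1ℤ                               ∎
  where open ≡-Reasoning

q-unit : ∀ {k w} → w ≤ k → q k w ≡ 1ℤ ⊎ q k w ≡ -1ℤ
q-unit w≤k with m≤n⇒m<n∨m≡n w≤k
q-unit {k}     _ | inj₂ refl        = inj₁ (q-diagonal k)
q-unit {suc k} _ | inj₁ (s≤s w≤k) = Sum.swap (Sum.map negate negate (q-unit w≤k))
  where
  negate : ∀ {i} → q k _ ≡ i → q (suc k) _ ≡ ℤ.- i
  negate q≡i = trans (q-alternates w≤k) (cong ℤ.-_ q≡i)

q-above : ∀ {k w} → k ≤ w → q k w ≡ ℤ.+ bound w k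
q-above {zero}  _ = refl
q-above {suc k} {suc w} (s≤s k≤w) with m≤n⇒m<n∨m≡n k≤w
... | inj₂ refl = trans (q-diagonal (suc k)) (cong ℤ.+_ (sym (bound-diagonal (suc k))))
... | inj₁ k<w = begin
    q (suc k) (suc w)
  ≡⟨ q-pascal k w ⟩
    q (suc k) w ℤ.+ ℤ.+ 2 ℤ.* q k w
  ≡⟨ cong₂ (λ i j → i ℤ.+ ℤ.+ 2 ℤ.* j) (q-above k<w) (q-above (<⇒≤ k<w)) ⟩
    ℤ.+ bound w (suc k) ℤ.+ ℤ.+ 2 ℤ.* ℤ.+ bound w k
  ≡⟨ cong (ℤ._+_ (ℤ.+ bound w (suc k))) (ℤₚ.pos-* 2 (bound w k)) ⟨
    ℤ.+ (bound w (suc k) + 2 * bound w k)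
  ≡⟨ cong ℤ.+_ (bound-pascal k<w) ⟨
    ℤ.+ bound (suc w) (suc k)
  ∎
  where open ≡-Reasoning

0≤1+q : ∀ k w → 0ℤ ℤ.≤ 1ℤ ℤ.+ q k w
0≤1+q k w with ≤-total w k
... | inj₂ k≤w = subst (λ i → 0ℤ ℤ.≤ 1ℤ ℤ.+ i) (sym (q-above k≤w)) (ℤ.+≤+ z≤n)
... | inj₁ w≤k with q-unit w≤k
...   | inj₁ q≡1  = subst (λ i → 0ℤ ℤ.≤ 1ℤ ℤ.+ i) (sym q≡1) (ℤ.+≤+ z≤n)
...   | inj₂ q≡-1 = subst (λ i → 0ℤ ℤ.≤ 1ℤ ℤ.+ i) (sym q≡-1) (ℤ.+≤+ z≤n)

-- 1 + q k w is never negative (0≤1+q), so ∣_∣ only moves it to ℕ.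
F : ℕ → ℕ → ℕ
F k w = ℤ.∣ 1ℤ ℤ.+ q k w ∣

+F≡1+q : ∀ k w → ℤ.+ F k w ≡ 1ℤ ℤ.+ q k w
+F≡1+q k w = ℤₚ.0≤i⇒+∣i∣≡i (0≤1+q k w)

F-recurrence : ∀ j w → F (suc j) w + F j w ≡ 2 + 2 ^ suc j * (w C suc j)
F-recurrence j w = ℤₚ.+-injective (begin
    ℤ.+ F (suc j) w ℤ.+ ℤ.+ F j w
  ≡⟨ cong₂ ℤ._+_ (+F≡1+q (suc j) w) (+F≡1+q j w) ⟩
    (1ℤ ℤ.+ (T ℤ.- q j w)) ℤ.+ (1ℤ ℤ.+ q j w)
  ≡⟨ identity T (q j w) ⟩
    ℤ.+ 2 ℤ.+ T
  ∎)
  where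
  open ≡-Reasoning
  T : ℤ
  T = ℤ.+ (2 ^ suc j * (w C suc j))
  identity : ∀ T Q → (1ℤ ℤ.+ (T ℤ.- Q)) ℤ.+ (1ℤ ℤ.+ Q) ≡ ℤ.+ 2 ℤ.+ T
  identity = ℤ-Ring.solve-∀

F-≤2 : ∀ {k w} → w ≤ k → F k w ≤ 2
F-≤2 w≤k with q-unit w≤k
... | inj₁ q≡1  = ≤-reflexive (cong (λ i → ℤ.∣ 1ℤ ℤ.+ i ∣) q≡1)
... | inj₂ q≡-1 = subst (_≤ 2) (cong (λ i → ℤ.∣ 1ℤ ℤ.+ i ∣) (sym q≡-1)) z≤n

F-above : ∀ {k w} → k ≤ w → F k w ≡ suc (bound w k)
F-above k≤w = cong (λ i → ℤ.∣ 1ℤ ℤ.+ i ∣) (q-above k≤w)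

-- Binomial moments of arrays with the same k-marginals

SameMarginals : ∀ {ν} → ℕ → Array ν → Array ν → Set
SameMarginals {ν} k N D = (S : Subset ν) → ∣ S ∣ ≡ k → extractArr S N ↭ extractArr S D

weightSum : (ℕ → ℕ) → Array ν → ℕ
weightSum f A = sum (map (λ r → f (weight r)) A)

𝟙[_⊆_] : ∀ {n} → Subset n → Row n → ℕ
𝟙[ []           ⊆ []        ] = 1
𝟙[ inside  ∷ T  ⊆ true  ∷ r ] = 𝟙[ T ⊆ r ]
𝟙[ inside  ∷ T  ⊆ false ∷ r ] = 0
𝟙[ outside ∷ T  ⊆ _     ∷ r ] = 𝟙[ T ⊆ r ]

subsetsOfSize : (n h : ℕ) → List (Subset n)
subsetsOfSize zero    zero    = [ [] ]
subsetsOfSize zero    (suc h) = []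
subsetsOfSize (suc n) zero    = map (outside ∷_) (subsetsOfSize n zero)
subsetsOfSize (suc n) (suc h) =
  map (inside ∷_) (subsetsOfSize n h) ++ map (outside ∷_) (subsetsOfSize n (suc h))

subsetsOfSize-size : ∀ n h → All (λ T → ∣ T ∣ ≡ h) (subsetsOfSize n h)
subsetsOfSize-size zero    zero    = refl ∷ []
subsetsOfSize-size zero    (suc h) = []
subsetsOfSize-size (suc n) zero    = map⁺ (subsetsOfSize-size n zero)
subsetsOfSize-size (suc n) (suc h) =
  ++⁺ (map⁺ (All.map (cong suc) (subsetsOfSize-size n h))) (map⁺ (subsetsOfSize-size n (suc h)))

sum-𝟙-subsetsOfSize-split : ∀ {n} b (r : Row n) h →
  sum (map 𝟙[_⊆ b ∷ r ] (subsetsOfSize (suc n) (suc h))) ≡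
  sum (map (λ T → 𝟙[ inside ∷ T ⊆ b ∷ r ]) (subsetsOfSize n h)) + sum (map 𝟙[_⊆ r ] (subsetsOfSize n (suc h)))
sum-𝟙-subsetsOfSize-split {n} b r h = begin
  sum (map 𝟙b (map (inside ∷_) Tₕ ++ map (outside ∷_) Tₕ₊₁))
    ≡⟨ cong sum (map-++ 𝟙b (map (inside ∷_) Tₕ) (map (outside ∷_) Tₕ₊₁)) ⟩
  sum (map 𝟙b (map (inside ∷_) Tₕ) ++ map 𝟙b (map (outside ∷_) Tₕ₊₁))
    ≡⟨ sum-++ (map 𝟙b (map (inside ∷_) Tₕ)) (map 𝟙b (map (outside ∷_) Tₕ₊₁)) ⟩
  sum (map 𝟙b (map (inside ∷_) Tₕ)) + sum (map 𝟙b (map (outside ∷_) Tₕ₊₁))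
    ≡⟨ cong₂ _+_ (cong sum (map-∘ Tₕ)) (cong sum (map-∘ Tₕ₊₁)) ⟨
  sum (map (λ T → 𝟙[ inside ∷ T ⊆ b ∷ r ]) Tₕ) + sum (map 𝟙[_⊆ r ] Tₕ₊₁)
    ∎
  where
  open ≡-Reasoning
  𝟙b : Subset (suc n) → ℕ
  𝟙b = 𝟙[_⊆ b ∷ r ]
  Tₕ Tₕ₊₁ : List (Subset n)
  Tₕ   = subsetsOfSize n h
  Tₕ₊₁ = subsetsOfSize n (suc h)

sum-𝟙-subsetsOfSize : ∀ {n} (r : Row n) h → sum (map 𝟙[_⊆ r ] (subsetsOfSize n h)) ≡ weight r C h
sum-𝟙-subsetsOfSize []          zero    = refl
sum-𝟙-subsetsOfSize []          (suc h) = refl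
sum-𝟙-subsetsOfSize {suc n} (b ∷ r) zero =
  trans (cong sum (sym (map-∘ (subsetsOfSize n zero)))) (sum-𝟙-subsetsOfSize r zero)
sum-𝟙-subsetsOfSize {suc n} (true ∷ r) (suc h) = begin
  sum (map 𝟙[_⊆ true ∷ r ] (subsetsOfSize (suc n) (suc h)))
    ≡⟨ sum-𝟙-subsetsOfSize-split true r h ⟩
  sum (map 𝟙[_⊆ r ] (subsetsOfSize n h)) + sum (map 𝟙[_⊆ r ] (subsetsOfSize n (suc h)))
    ≡⟨ cong₂ _+_ (sum-𝟙-subsetsOfSize r h) (sum-𝟙-subsetsOfSize r (suc h)) ⟩
  weight r C h + weight r C suc h
    ≡⟨ C-pascal (weight r) h ⟨
  suc (weight r) C suc h
    ∎
  where open ≡-Reasoning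
sum-𝟙-subsetsOfSize {suc n} (false ∷ r) (suc h) = begin
  sum (map 𝟙[_⊆ false ∷ r ] (subsetsOfSize (suc n) (suc h)))
    ≡⟨ sum-𝟙-subsetsOfSize-split false r h ⟩
  sum (map (λ _ → 0) (subsetsOfSize n h)) + sum (map 𝟙[_⊆ r ] (subsetsOfSize n (suc h)))
    ≡⟨ cong₂ _+_ (sum-map-zero (subsetsOfSize n h)) (sum-𝟙-subsetsOfSize r (suc h)) ⟩
  weight r C suc h
    ∎
  where open ≡-Reasoning

⊆-extend : ∀ {n} (T : Subset n) {k} → ∣ T ∣ ≤ k → k ≤ n → ∃[ S ] T ⊆ S × ∣ S ∣ ≡ k
⊆-extend []            {zero}  _ _ = [] , ⊆-refl , refl
⊆-extend (inside ∷ T)  {suc k} (s≤s ∣T∣≤k) (s≤s k≤n) with ⊆-extend T ∣T∣≤k k≤n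
... | S , T⊆S , ∣S∣≡k = inside ∷ S , in⊆in T⊆S , cong suc ∣S∣≡k
⊆-extend {suc n} (outside ∷ T) {k} ∣T∣≤k k≤1+n with k ≤? n
... | yes k≤n with ⊆-extend T ∣T∣≤k k≤n
...   | S , T⊆S , ∣S∣≡k = outside ∷ S , s⊆s T⊆S , ∣S∣≡k
⊆-extend {suc n} (outside ∷ T) {k} ∣T∣≤k k≤1+n | no k≰n with ⊆-extend T (∣p∣≤n T) ≤-refl
... | S , T⊆S , ∣S∣≡n =
  inside ∷ S , out⊆ T⊆S , trans (cong suc ∣S∣≡n) (≤-antisym (≰⇒> k≰n) k≤1+n)

𝟙-extract : ∀ {n} (T S : Subset n) → T ⊆ S → (r : Row n) →
  𝟙[ T ⊆ r ] ≡ 𝟙[ extract S T ⊆ extract S r ]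
𝟙-extract []            []            _   []          = refl
𝟙-extract (inside ∷ T)  (inside ∷ S)  T⊆S (true ∷ r)  = 𝟙-extract T S (drop-∷-⊆ T⊆S) r
𝟙-extract (inside ∷ T)  (inside ∷ S)  _   (false ∷ r) = refl
𝟙-extract (inside ∷ T)  (outside ∷ S) T⊆S _           with T⊆S Vec.here
... | ()
𝟙-extract (outside ∷ T) (inside ∷ S)  T⊆S (_ ∷ r)     = 𝟙-extract T S (drop-∷-⊆ T⊆S) r
𝟙-extract (outside ∷ T) (outside ∷ S) T⊆S (_ ∷ r)     = 𝟙-extract T S (drop-∷-⊆ T⊆S) r

covering-counts-agree : {N D : Array ν} → SameMarginals k N D → k ≤ ν →
  (T : Subset ν) → ∣ T ∣ ≤ k → sum (map 𝟙[ T ⊆_] N) ≡ sum (map 𝟙[ T ⊆_] D)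
covering-counts-agree {N = N} {D} same k≤ν T ∣T∣≤k with ⊆-extend T ∣T∣≤k k≤ν
... | S , T⊆S , ∣S∣≡k = begin
  sum (map 𝟙[ T ⊆_] N)                           ≡⟨ restrict N ⟩
  sum (map 𝟙[ extract S T ⊆_] (extractArr S N))  ≡⟨ sum-↭ (↭ₚ.map⁺ _ (same S ∣S∣≡k)) ⟩
  sum (map 𝟙[ extract S T ⊆_] (extractArr S D))  ≡⟨ restrict D ⟨
  sum (map 𝟙[ T ⊆_] D)                           ∎
  where
  open ≡-Reasoning
  restrict : ∀ A → sum (map 𝟙[ T ⊆_] A) ≡ sum (map 𝟙[ extract S T ⊆_] (extractArr S A))
  restrict A = cong sum (trans (map-cong (𝟙-extract T S T⊆S) A) (map-∘ A))

binomial-moments-agree : {N D : Array ν} → SameMarginals k N D → k ≤ ν →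
  ∀ {h} → h ≤ k → weightSum (_C h) N ≡ weightSum (_C h) D
binomial-moments-agree {ν} {k} {N} {D} same k≤ν {h} h≤k = begin
  weightSum (_C h) N                                            ≡⟨ by-subsets N ⟩
  sum (map (λ T → sum (map 𝟙[ T ⊆_] N)) (subsetsOfSize ν h))   ≡⟨ cong sum (map-cong-local agree) ⟩
  sum (map (λ T → sum (map 𝟙[ T ⊆_] D)) (subsetsOfSize ν h))   ≡⟨ by-subsets D ⟨
  weightSum (_C h) D                                            ∎
  where
  open ≡-Reasoning
  by-subsets : ∀ A → weightSum (_C h) A ≡ sum (map (λ T → sum (map 𝟙[ T ⊆_] A)) (subsetsOfSize ν h))
  by-subsets A = trans (cong sum (map-cong (λ r → sym (sum-𝟙-subsetsOfSize r h)) A))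
                       (sum-map-swap (λ r T → 𝟙[ T ⊆ r ]) A (subsetsOfSize ν h))
  agree : All (λ T → sum (map 𝟙[ T ⊆_] N) ≡ sum (map 𝟙[ T ⊆_] D)) (subsetsOfSize ν h)
  agree = All.map (λ {T} ∣T∣≡h → covering-counts-agree same k≤ν T (subst (_≤ k) (sym ∣T∣≡h) h≤k))
                  (subsetsOfSize-size ν h)

-- F 0 w and 2 * (w C 0) both compute to 2, so the constant 2 in F-recurrence is a zeroth moment.
F-moments-agree : {N D : Array ν} → SameMarginals k N D → k ≤ ν →
  ∀ {j} → j ≤ k → weightSum (F j) N ≡ weightSum (F j) D
F-moments-agree {N = N} {D} same k≤ν {zero} _ = begin
  weightSum (F 0) N       ≡⟨ sum-map-* 2 (λ r → weight r C 0) N ⟩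
  2 * weightSum (_C 0) N  ≡⟨ cong (2 *_) (binomial-moments-agree same k≤ν z≤n) ⟩
  2 * weightSum (_C 0) D  ≡⟨ sum-map-* 2 (λ r → weight r C 0) D ⟨
  weightSum (F 0) D       ∎
  where open ≡-Reasoning
F-moments-agree {k = k} {N = N} {D} same k≤ν {suc j} j<k = +-cancelʳ-≡ (weightSum (F j) N) _ _ (begin
  weightSum (F (suc j)) N + weightSum (F j) N
    ≡⟨ recurrence N ⟩
  2 * weightSum (_C 0) N + 2 ^ suc j * weightSum (_C suc j) N
    ≡⟨ cong₂ (λ m₀ m₁ → 2 * m₀ + 2 ^ suc j * m₁) (moment z≤n) (moment j<k) ⟩
  2 * weightSum (_C 0) D + 2 ^ suc j * weightSum (_C suc j) D
    ≡⟨ recurrence D ⟨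
  weightSum (F (suc j)) D + weightSum (F j) D
    ≡⟨ cong (weightSum (F (suc j)) D +_) (F-moments-agree same k≤ν (<⇒≤ j<k)) ⟨
  weightSum (F (suc j)) D + weightSum (F j) N
    ∎)
  where
  open ≡-Reasoning
  moment : ∀ {h} → h ≤ k → weightSum (_C h) N ≡ weightSum (_C h) D
  moment = binomial-moments-agree same k≤ν
  recurrence : ∀ A → weightSum (F (suc j)) A + weightSum (F j) A ≡
                     2 * weightSum (_C 0) A + 2 ^ suc j * weightSum (_C suc j) A
  recurrence A = begin
    weightSum (F (suc j)) A + weightSum (F j) A
      ≡⟨ sum-map-+ (F (suc j) ∘ weight) (F j ∘ weight) A ⟨
    sum (map (λ r → F (suc j) (weight r) + F j (weight r)) A)
      ≡⟨ cong sum (map-cong (λ r → F-recurrence j (weight r)) A) ⟩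
    sum (map (λ r → 2 * (weight r C 0) + 2 ^ suc j * (weight r C suc j)) A)
      ≡⟨ sum-map-+ (λ r → 2 * (weight r C 0)) (λ r → 2 ^ suc j * (weight r C suc j)) A ⟩
    sum (map (λ r → 2 * (weight r C 0)) A) + sum (map (λ r → 2 ^ suc j * (weight r C suc j)) A)
      ≡⟨ cong₂ _+_ (sum-map-* 2 (λ r → weight r C 0) A)
                   (sum-map-* (2 ^ suc j) (λ r → weight r C suc j) A) ⟩
    2 * weightSum (_C 0) A + 2 ^ suc j * weightSum (_C suc j) A
      ∎

=ᵇones⇒weight≡ : ∀ {ν} (r : Row ν) → (r =ᵇ ones ν) ≡ true → weight r ≡ ν
=ᵇones⇒weight≡ []          _  = refl
=ᵇones⇒weight≡ (true ∷ r)  eq = cong suc (=ᵇones⇒weight≡ r eq)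

Rstar-*-≤-weightSum : (f : ℕ → ℕ) (A : Array ν) → Rstar A * f ν ≤ weightSum f A
Rstar-*-≤-weightSum f [] = z≤n
Rstar-*-≤-weightSum {ν} f (r ∷ A) with r =ᵇ ones ν in eq
... | true  = +-mono-≤ (≤-reflexive (cong f (sym (=ᵇones⇒weight≡ r eq)))) (Rstar-*-≤-weightSum f A)
... | false = m≤n⇒m≤o+n (f (weight r)) (Rstar-*-≤-weightSum f A)

theorem3 : (k ν : ℕ) → 1 ≤ k → k < ν → (N D : Array ν) → InΔ ν k k N D →
    Rstar N * (bound ν k + 1) ≤ 2 * R D
theorem3 k ν _ k<ν N D Δ = begin
  Rstar N * (bound ν k + 1)  ≡⟨ cong (Rstar N *_) (trans (+-comm (bound ν k) 1) (sym (F-above k≤ν))) ⟩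
  Rstar N * F k ν            ≤⟨ Rstar-*-≤-weightSum (F k) N ⟩
  weightSum (F k) N          ≡⟨ F-moments-agree kMarginal k≤ν ≤-refl ⟩
  weightSum (F k) D          ≤⟨ sum-map-≤ (λ r∈D → F-≤2 (weightD r∈D)) ⟩
  2 * length D               ∎
  where
  open InΔ Δ
  open ≤-Reasoning
  k≤ν : k ≤ ν
  k≤ν = <⇒≤ k<ν
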